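{- Let $D_0$ be a diagram with at most one cell in each column, let $m=|D_0|$, and suppose the nonempty columns of $D_0$ are exactly columns $1,\dots,m$. Then $\mathcal{P}(D_0)$ is bounded, and its unique minimal element is $\{(1,1),(1,2),\dots,(1,m)\}$.
   Context: A diagram is a finite set $D$ of cells $(r,c)$ with $r,c$ positive integers; $r$ is the row (rows numbered from bottom to top starting at 1) and $c$ the column (numbered from left to right starting at 1). A Kohnert move at row $r$ applied to a diagram $D$: if row $r$ of $D$ is empty, $D$ is unchanged; otherwise let $(r,c)$ be the cell of row $r$ with the largest column index; if every position $(r',c)$ with $1\le r'<r$ belongs to $D$, then $D$ is unchanged; otherwise let $r'$ be the largest integer with $1\le r'<r$ and $(r',c)\notin D$, and the move replaces the cell $(r,c)$ by $(r',c)$. For a diagram $D_0$, $KD(D_0)$ is the set of all diagrams obtainable from $D_0$ by finite (possibly empty) sequences of Kohnert moves. The Kohnert poset $\mathcal{P}(D_0)$ is $KD(D_0)$ ordered by $D_2\preceq D_1$ iff $D_2$ can be obtained from $D_1$ by a finite sequence of Kohnert moves. A finite poset is bounded if it has a unique minimal element and a unique maximal element. -}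

module Defs where

open import Data.Nat using (ℕ; suc; _≤_; _<_)
open import Data.Product using (_×_; _,_; Σ; proj₁; proj₂)
open import Data.Sum using (_⊎_)
open import Data.List using (List; map; upTo)
open import Data.List.Membership.Propositional using (_∈_; _∉_)
open import Relation.Binary.PropositionalEquality using (_≡_; _≢_)
open import Relation.Binary.Construct.Closure.ReflexiveTransitive using (Star)
open import Function.Bundles using (_⇔_)

-- A cell (r , c): r = row (bottom to top, from 1), c = column (from 1).
Cell : Set
Cell = ℕ × ℕ

-- A diagram is a finite set of cells, represented by a list;
-- two lists represent the same diagram iff they have the same members.
Diagram : Set
Diagram = List Cell

_≐_ : Diagram → Diagram → Set
D ≐ E = ∀ x → x ∈ D ⇔ x ∈ E

-- A (non-trivial) Kohnert move at row r taking D to E: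
-- (r , c) is the rightmost cell of row r, r' is the largest row index
-- 1 ≤ r' < r with (r' , c) ∉ D, and E = (D ∖ {(r , c)}) ∪ {(r' , c)}.
-- (The cases where the move leaves D unchanged are covered by reflexivity
-- of the reachability relation below.)
data KohnertMove (D E : Diagram) : Set where
  move : (r c r' : ℕ) →
         (r , c) ∈ D →
         (∀ c' → (r , c') ∈ D → c' ≤ c) →
         1 ≤ r' → r' < r → (r' , c) ∉ D →
         (∀ s → r' < s → s < r → (s , c) ∈ D) →
         (∀ x → x ∈ E ⇔ ((x ∈ D × x ≢ (r , c)) ⊎ x ≡ (r' , c))) →
         KohnertMove D E

Reach : Diagram → Diagram → Set
Reach D E = Σ Diagram λ E' → Star KohnertMove D E' × (E' ≐ E)

InKD : Diagram → Diagram → Set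
InKD D₀ D = Reach D₀ D

_⪯_ : Diagram → Diagram → Set
D₂ ⪯ D₁ = Reach D₁ D₂

IsMinimal : Diagram → Diagram → Set
IsMinimal D₀ M = InKD D₀ M × (∀ E → InKD D₀ E → E ⪯ M → E ≐ M)

IsMaximal : Diagram → Diagram → Set
IsMaximal D₀ M = InKD D₀ M × (∀ E → InKD D₀ E → M ⪯ E → E ≐ M)

Bounded : Diagram → Set
Bounded D₀ =
  (Σ Diagram λ M → IsMinimal D₀ M × (∀ M' → IsMinimal D₀ M' → M' ≐ M)) ×
  (Σ Diagram λ M → IsMaximal D₀ M × (∀ M' → IsMaximal D₀ M' → M' ≐ M))

bottomRow : ℕ → Diagram
bottomRow m = map (λ i → (1 , suc i)) (upTo m)

{-# OPTIONS --safe #-}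
-- A Kohnert move lowers one cell inside its own column. Hence every diagram
-- reachable from D₀ still has exactly one cell in each of the columns 1, …, m,
-- and lies weakly below D₀ column by column. A move out of a diagram with one
-- cell per column strictly lowers the only cell of its column, which no later
-- move can raise again; so the Kohnert order is antisymmetric on P(D₀) and D₀ is
-- its unique maximum. Moreover, as long as some cell lies above row 1, the
-- rightmost cell of its row has a free position directly below it; that move
-- lowers the sum of the row indices, so every element of P(D₀) descends to the
-- bottom row {(1,1), …, (1,m)}, where no move is possible.
module Submission where

open import Defs
open import Data.Nat using (ℕ; suc; _≤_; _<_; _≤?_; z≤n; s≤s)
open import Data.Nat.Properties
open import Data.Nat.Induction using (<-wellFounded)
open import Induction.WellFounded using (Acc; acc)
open import Data.Product using (_×_; _,_; Σ; proj₁; proj₂)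
import Data.Product as Product
open import Data.Product.Properties using (≡-dec)
open import Data.Sum using (_⊎_; inj₁; inj₂)
import Data.Sum as Sum
open import Data.Empty using (⊥-elim)
open import Data.List using (length; []; _∷_; map; filter)
open import Data.Nat.ListAction using (sum)
open import Data.List.Extrema.Nat using (argmax; argmax-all; f[xs]≤f[argmax])
open import Data.List.Membership.Propositional using (_∈_; _∉_; find)
open import Data.List.Membership.Propositional.Properties
  using (∈-map⁺; ∈-map⁻; ∈-upTo⁺; ∈-upTo⁻; ∈-filter⁺; ∈-filter⁻)
open import Data.List.Relation.Unary.Any using (here; there; any?)
import Data.List.Relation.Unary.All as All
open import Data.List.Relation.Unary.All.Properties using (¬Any⇒All¬)
open import Data.List.Relation.Unary.Unique.Propositional using (Unique)
open import Relation.Binary.Definitions using (DecidableEquality)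
open import Relation.Binary.PropositionalEquality using (_≡_; _≢_; refl; sym; subst)
open import Relation.Binary.Construct.Closure.ReflexiveTransitive using (Star; ε; _◅_; _◅◅_)
open import Relation.Nullary using (¬_; Dec; yes; no)
open import Function using (_∘_)
open import Function.Bundles using (_⇔_; mk⇔; Equivalence)
import Function.Properties.Equivalence as ⇔

open Equivalence

≐-refl : ∀ {D} → D ≐ D
≐-refl x = ⇔.refl

≐-sym : ∀ {D E} → D ≐ E → E ≐ D
≐-sym D≐E x = ⇔.sym (D≐E x)

≐-trans : ∀ {D E F} → D ≐ E → E ≐ F → D ≐ F
≐-trans D≐E E≐F x = ⇔.trans (D≐E x) (E≐F x)

move-respˡ-≐ : ∀ {D D′ E} → D ≐ D′ → KohnertMove D E → KohnertMove D′ E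
move-respˡ-≐ D≐D′ (move r c r′ rc rightmost 1≤r′ r′<r free between E≡) =
  move r c r′ (to (D≐D′ _) rc) (λ c′ → rightmost c′ ∘ from (D≐D′ _)) 1≤r′ r′<r
       (free ∘ from (D≐D′ _)) (λ s p q → to (D≐D′ _) (between s p q))
       (λ x → ⇔.trans (E≡ x) (mk⇔ (Sum.map₁ (Product.map₁ (to (D≐D′ x))))
                                  (Sum.map₁ (Product.map₁ (from (D≐D′ x))))))

star-respˡ-≐ : ∀ {D D′ E} → D ≐ D′ → Star KohnertMove D E → Reach D′ E
star-respˡ-≐ D≐D′ ε = _ , ε , ≐-sym D≐D′
star-respˡ-≐ D≐D′ (mv ◅ s) = _ , move-respˡ-≐ D≐D′ mv ◅ s , ≐-refl

≐⇒Reach : ∀ {D E} → D ≐ E → Reach D E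
≐⇒Reach D≐E = _ , ε , D≐E

move⇒Reach : ∀ {D E} → KohnertMove D E → Reach D E
move⇒Reach mv = _ , mv ◅ ε , ≐-refl

reach-trans : ∀ {D E F} → Reach D E → Reach E F → Reach D F
reach-trans (E′ , s , E′≐E) (F′ , t , F′≐F) =
  let (F″ , t′ , F″≐F′) = star-respˡ-≐ (≐-sym E′≐E) t
  in F″ , s ◅◅ t′ , ≐-trans F″≐F′ F′≐F

KohnertInvariant : (Diagram → Set) → Set
KohnertInvariant P =
  (∀ {D E} → D ≐ E → P D → P E) × (∀ {D E} → KohnertMove D E → P D → P E)

reach-preserves : ∀ {P} → KohnertInvariant P → ∀ {D E} → Reach D E → P D → P E
reach-preserves {P} (resp , step) (_ , s , E′≐E) = resp E′≐E ∘ star s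
  where
  star : ∀ {D E} → Star KohnertMove D E → P D → P E
  star ε = λ p → p
  star (mv ◅ s) = star s ∘ step mv

OneCellPerColumn : Diagram → Set
OneCellPerColumn D = ∀ x y → x ∈ D → y ∈ D → proj₂ x ≡ proj₂ y → x ≡ y

RowsPositive : Diagram → Set
RowsPositive D = ∀ x → x ∈ D → 1 ≤ proj₁ x

Occupies : Diagram → ℕ → Set
Occupies D c = Σ ℕ λ r → (r , c) ∈ D

ColumnsOneTo : ℕ → Diagram → Set
ColumnsOneTo m D = ∀ c → Occupies D c ⇔ (1 ≤ c × c ≤ m)

oneCellPerColumn-invariant : KohnertInvariant OneCellPerColumn
oneCellPerColumn-invariant =
  (λ D≐E one x y x∈E y∈E → one x y (from (D≐E x) x∈E) (from (D≐E y) y∈E)) , step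
  where
  step : ∀ {D E} → KohnertMove D E → OneCellPerColumn D → OneCellPerColumn E
  step (move r c r′ rc _ _ _ _ _ E≡) one x y x∈E y∈E same
    with to (E≡ x) x∈E | to (E≡ y) y∈E
  ... | inj₁ (x∈D , _)   | inj₁ (y∈D , _)   = one x y x∈D y∈D same
  ... | inj₁ (x∈D , x≢rc) | inj₂ refl       = ⊥-elim (x≢rc (one x _ x∈D rc same))
  ... | inj₂ refl        | inj₁ (y∈D , y≢rc) = ⊥-elim (y≢rc (one y _ y∈D rc (sym same)))
  ... | inj₂ refl        | inj₂ refl        = refl

rowsPositive-invariant : KohnertInvariant RowsPositive
rowsPositive-invariant = (λ D≐E pos x x∈E → pos x (from (D≐E x) x∈E)) , step
  where
  step : ∀ {D E} → KohnertMove D E → RowsPositive D → RowsPositive E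
  step (move _ _ _ _ _ 1≤r′ _ _ _ E≡) pos x x∈E with to (E≡ x) x∈E
  ... | inj₁ (x∈D , _) = pos x x∈D
  ... | inj₂ refl = 1≤r′

_≟ᶜ_ : DecidableEquality Cell
_≟ᶜ_ = ≡-dec _≟_ _≟_

move-occupies : ∀ {D E} → KohnertMove D E → ∀ c → Occupies D c ⇔ Occupies E c
move-occupies {D} {E} (move r c r′ rc _ _ _ _ _ E≡) c₀ = mk⇔ forth back
  where
  forth : Occupies D c₀ → Occupies E c₀
  forth (s , sc₀) with (s , c₀) ≟ᶜ (r , c)
  ... | yes refl = r′ , from (E≡ _) (inj₂ refl)
  ... | no ≢rc = s , from (E≡ _) (inj₁ (sc₀ , ≢rc))
  back : Occupies E c₀ → Occupies D c₀
  back (s , sc₀) with to (E≡ _) sc₀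
  ... | inj₁ (sc₀∈D , _) = s , sc₀∈D
  ... | inj₂ refl = r , rc

columnsOneTo-invariant : ∀ {m} → KohnertInvariant (ColumnsOneTo m)
columnsOneTo-invariant =
  (λ D≐E cols c → ⇔.trans (mk⇔ (occupies (≐-sym D≐E)) (occupies D≐E)) (cols c)) ,
  (λ mv cols c → ⇔.trans (⇔.sym (move-occupies mv c)) (cols c))
  where
  occupies : ∀ {D E c} → D ≐ E → Occupies D c → Occupies E c
  occupies D≐E (r , rc) = r , to (D≐E _) rc

Dominates : Diagram → Diagram → Set
Dominates A B = ∀ r c → (r , c) ∈ B → Σ ℕ λ r′ → r ≤ r′ × (r′ , c) ∈ A

dominates-refl : ∀ {A} → Dominates A A
dominates-refl r c rc = r , ≤-refl , rc

dominates-trans : ∀ {A B C} → Dominates A B → Dominates B C → Dominates A C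
dominates-trans A≽B B≽C r c rc =
  let (r₁ , r≤r₁ , r₁c) = B≽C r c rc
      (r₂ , r₁≤r₂ , r₂c) = A≽B r₁ c r₁c
  in r₂ , ≤-trans r≤r₁ r₁≤r₂ , r₂c

move-dominates : ∀ {D E} → KohnertMove D E → Dominates D E
move-dominates (move r c r′ rc _ _ r′<r _ _ E≡) s c₀ sc₀ with to (E≡ _) sc₀
... | inj₁ (sc₀∈D , _) = s , ≤-refl , sc₀∈D
... | inj₂ refl = r , <⇒≤ r′<r , rc

reach-dominates : ∀ {D E} → Reach D E → Dominates D E
reach-dominates (_ , s , E′≐E) r c rc = star s r c (from (E′≐E _) rc)
  where
  star : ∀ {D E} → Star KohnertMove D E → Dominates D E
  star ε = dominates-refl
  star (mv ◅ s) = dominates-trans (move-dominates mv) (star s)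

move-undominated : ∀ {D E} → OneCellPerColumn D → KohnertMove D E → ¬ Dominates E D
move-undominated one (move r c r′ rc _ _ r′<r _ _ E≡) E≽D
  with E≽D r c rc
... | s , r≤s , sc with to (E≡ _) sc
...   | inj₁ (sc∈D , sc≢rc) = sc≢rc (one _ _ sc∈D rc refl)
...   | inj₂ refl = <⇒≱ r′<r r≤s

reach-antisym : ∀ {D E} → OneCellPerColumn D → Reach D E → Reach E D → E ≐ D
reach-antisym one (_ , ε , D≐E) E⇝D = ≐-sym D≐E
reach-antisym one (E′ , mv ◅ s , E′≐E) E⇝D =
  ⊥-elim (move-undominated one mv (reach-dominates (reach-trans (E′ , s , E′≐E) E⇝D)))

InRowOne : Diagram → Set
InRowOne D = ∀ x → x ∈ D → proj₁ x ≡ 1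

rowOne-stuck : ∀ {D E} → InRowOne D → ¬ KohnertMove D E
rowOne-stuck rowOne (move r c r′ rc _ 1≤r′ r′<r _ _ _) with rowOne _ rc
... | refl = <⇒≱ r′<r 1≤r′

reach-from-rowOne : ∀ {D E} → InRowOne D → Reach D E → E ≐ D
reach-from-rowOne rowOne (_ , ε , D≐E) = ≐-sym D≐E
reach-from-rowOne rowOne (_ , mv ◅ _ , _) = ⊥-elim (rowOne-stuck rowOne mv)

∈-bottomRow⁺ : ∀ {m c} → 1 ≤ c → c ≤ m → (1 , c) ∈ bottomRow m
∈-bottomRow⁺ {c = suc c} _ c<m = ∈-map⁺ (λ i → 1 , suc i) (∈-upTo⁺ c<m)

∈-bottomRow⁻ : ∀ {m r c} → (r , c) ∈ bottomRow m → r ≡ 1 × 1 ≤ c × c ≤ m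
∈-bottomRow⁻ rc with ∈-map⁻ (λ i → 1 , suc i) rc
... | i , i<m , refl = refl , s≤s z≤n , ∈-upTo⁻ i<m

bottomRow-inRowOne : ∀ {m} → InRowOne (bottomRow m)
bottomRow-inRowOne x x∈ = proj₁ (∈-bottomRow⁻ x∈)

rowOne⇒≐bottomRow : ∀ {m D} → InRowOne D → ColumnsOneTo m D → D ≐ bottomRow m
rowOne⇒≐bottomRow {m} {D} rowOne cols (r , c) = mk⇔ forth back
  where
  forth : (r , c) ∈ D → (r , c) ∈ bottomRow m
  forth rc with rowOne _ rc
  ... | refl = let (1≤c , c≤m) = to (cols c) (r , rc) in ∈-bottomRow⁺ 1≤c c≤m
  back : (r , c) ∈ bottomRow m → (r , c) ∈ D
  back rc with ∈-bottomRow⁻ rc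
  ... | refl , 1≤c , c≤m with from (cols c) (1≤c , c≤m)
  ...   | s , sc with rowOne _ sc
  ...     | refl = sc

rightmostInRow : ∀ {r c₀} D → (r , c₀) ∈ D →
                 Σ ℕ λ c → (r , c) ∈ D × (∀ c′ → (r , c′) ∈ D → c′ ≤ c)
rightmostInRow {r} {c₀} D rc₀ =
  proj₂ x , subst (λ s → (s , proj₂ x) ∈ D) row-x x∈D , rightmost
  where
  inRow? : (y : Cell) → Dec (proj₁ y ≡ r)
  inRow? y = proj₁ y ≟ r
  row : Diagram
  row = filter inRow? D
  x : Cell
  x = argmax proj₂ (r , c₀) row
  x∈Row : x ∈ D × proj₁ x ≡ r
  x∈Row = argmax-all proj₂ (rc₀ , refl) (All.tabulate (∈-filter⁻ inRow?))
  x∈D : x ∈ D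
  x∈D = proj₁ x∈Row
  row-x : proj₁ x ≡ r
  row-x = proj₂ x∈Row
  rightmost : ∀ c′ → (r , c′) ∈ D → c′ ≤ proj₂ x
  rightmost c′ rc′ = All.lookup (f[xs]≤f[argmax] (r , c₀) row) (∈-filter⁺ inRow? rc′ refl)

substitute : Cell → Cell → Cell → Cell
substitute a b x with x ≟ᶜ a
... | yes _ = b
... | no _ = x

substitute-self : ∀ a b → substitute a b a ≡ b
substitute-self a b with a ≟ᶜ a
... | yes _ = refl
... | no a≢a = ⊥-elim (a≢a refl)

substitute-other : ∀ {a x} b → x ≢ a → substitute a b x ≡ x
substitute-other {a} {x} b x≢a with x ≟ᶜ a
... | yes x≡a = ⊥-elim (x≢a x≡a)
... | no _ = refl

replace : Cell → Cell → Diagram → Diagram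
replace a b = map (substitute a b)

∈-replace : ∀ {a b D} → a ∈ D → ∀ x → x ∈ replace a b D ⇔ ((x ∈ D × x ≢ a) ⊎ x ≡ b)
∈-replace {a} {b} {D} a∈D x = mk⇔ forth back
  where
  forth : x ∈ replace a b D → (x ∈ D × x ≢ a) ⊎ x ≡ b
  forth x∈ with ∈-map⁻ (substitute a b) x∈
  ... | y , y∈D , refl with y ≟ᶜ a
  ...   | yes _ = inj₂ refl
  ...   | no y≢a = inj₁ (y∈D , y≢a)
  back : (x ∈ D × x ≢ a) ⊎ x ≡ b → x ∈ replace a b D
  back (inj₁ (x∈D , x≢a)) =
    subst (_∈ replace a b D) (substitute-other b x≢a) (∈-map⁺ (substitute a b) x∈D)
  back (inj₂ refl) =
    subst (_∈ replace a b D) (substitute-self a b) (∈-map⁺ (substitute a b) a∈D)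

rowSum : Diagram → ℕ
rowSum D = sum (map proj₁ D)

substitute-row-≤ : ∀ {a b} → proj₁ b ≤ proj₁ a → ∀ x → proj₁ (substitute a b x) ≤ proj₁ x
substitute-row-≤ {a} b≤a x with x ≟ᶜ a
... | yes refl = b≤a
... | no _ = ≤-refl

rowSum-replace-≤ : ∀ {a b} → proj₁ b ≤ proj₁ a → ∀ D → rowSum (replace a b D) ≤ rowSum D
rowSum-replace-≤ b≤a [] = z≤n
rowSum-replace-≤ b≤a (x ∷ D) = +-mono-≤ (substitute-row-≤ b≤a x) (rowSum-replace-≤ b≤a D)

rowSum-replace-< : ∀ {a b D} → proj₁ b < proj₁ a → a ∈ D → rowSum (replace a b D) < rowSum D
rowSum-replace-< {a} {b} {x ∷ D} b<a (here refl) rewrite substitute-self a b =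
  +-mono-<-≤ b<a (rowSum-replace-≤ (<⇒≤ b<a) D)
rowSum-replace-< {D = x ∷ D} b<a (there a∈D) =
  +-mono-≤-< (substitute-row-≤ (<⇒≤ b<a) x) (rowSum-replace-< b<a a∈D)

moveDown : ∀ {D r c} → OneCellPerColumn D → (suc r , c) ∈ D →
           (∀ c′ → (suc r , c′) ∈ D → c′ ≤ c) → 1 ≤ r →
           KohnertMove D (replace (suc r , c) (r , c) D)
moveDown {D} {r} {c} one rc rightmost 1≤r =
  move (suc r) c r rc rightmost 1≤r ≤-refl below-free nothing-between (∈-replace rc)
  where
  below-free : (r , c) ∉ D
  below-free rc′ with one _ _ rc′ rc refl
  ... | ()
  nothing-between : ∀ s → r < s → s < suc r → (s , c) ∈ D
  nothing-between s r<s s<1+r = ⊥-elim (<⇒≱ s<1+r r<s)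

rowOne-or-above : ∀ {D} → RowsPositive D →
                  InRowOne D ⊎ Σ ℕ λ r → Σ ℕ λ c → 1 ≤ r × (suc r , c) ∈ D
rowOne-or-above {D} pos with any? (λ x → 2 ≤? proj₁ x) D
... | no none = inj₁ λ x x∈D → ≤-antisym (≮⇒≥ (All.lookup (¬Any⇒All¬ D none) x∈D)) (pos x x∈D)
... | yes some with find some
...   | (suc r , c) , rc , s≤s 1≤r = inj₂ (r , c , 1≤r , rc)

descendToRowOne : ∀ {D} → OneCellPerColumn D → RowsPositive D → Acc _<_ (rowSum D) →
                  Σ Diagram λ E → Reach D E × InRowOne E
descendToRowOne {D} one pos (acc smaller) with rowOne-or-above pos
... | inj₁ rowOne = D , ≐⇒Reach ≐-refl , rowOne
... | inj₂ (r , c₀ , 1≤r , rc₀) =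
  let (c , rc , rightmost) = rightmostInRow D rc₀
      step = moveDown one rc rightmost 1≤r
      (E , F⇝E , rowOne) = descendToRowOne (proj₂ oneCellPerColumn-invariant step one)
                                            (proj₂ rowsPositive-invariant step pos)
                                            (smaller (rowSum-replace-< ≤-refl rc))
  in E , reach-trans (move⇒Reach step) F⇝E , rowOne

reach-bottomRow : ∀ {m D} → OneCellPerColumn D → RowsPositive D → ColumnsOneTo m D →
                  Reach D (bottomRow m)
reach-bottomRow one pos cols =
  let (E , D⇝E , rowOne) = descendToRowOne one pos (<-wellFounded _)
  in reach-trans D⇝E (≐⇒Reach (rowOne⇒≐bottomRow rowOne
                                 (reach-preserves columnsOneTo-invariant D⇝E cols)))

theorem4p2 : (D₀ : Diagram) (m : ℕ) →
    Unique D₀ → length D₀ ≡ m →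
    (∀ x → x ∈ D₀ → 1 ≤ proj₁ x) →
    (∀ x y → x ∈ D₀ → y ∈ D₀ → proj₂ x ≡ proj₂ y → x ≡ y) →
    (∀ c → (Σ ℕ λ r → (r , c) ∈ D₀) ⇔ (1 ≤ c × c ≤ m)) →
    Bounded D₀ × IsMinimal D₀ (bottomRow m)
theorem4p2 D₀ m _ _ pos one cols =
  ((bottomRow m , minimal , minimal-unique) , (D₀ , maximal , maximal-unique)) , minimal
  where
  toBottom : ∀ {E} → InKD D₀ E → Reach E (bottomRow m)
  toBottom D₀⇝E = reach-bottomRow (reach-preserves oneCellPerColumn-invariant D₀⇝E one)
                                  (reach-preserves rowsPositive-invariant D₀⇝E pos)
                                  (reach-preserves columnsOneTo-invariant D₀⇝E cols)
  minimal : IsMinimal D₀ (bottomRow m)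
  minimal = toBottom (≐⇒Reach ≐-refl) , λ _ _ → reach-from-rowOne bottomRow-inRowOne
  minimal-unique : ∀ M → IsMinimal D₀ M → M ≐ bottomRow m
  minimal-unique M (D₀⇝M , least) = ≐-sym (least (bottomRow m) (proj₁ minimal) (toBottom D₀⇝M))
  maximal : IsMaximal D₀ D₀
  maximal = ≐⇒Reach ≐-refl , λ _ D₀⇝E E⇝D₀ → reach-antisym one D₀⇝E E⇝D₀
  maximal-unique : ∀ M → IsMaximal D₀ M → M ≐ D₀
  maximal-unique M (D₀⇝M , greatest) = ≐-sym (greatest D₀ (≐⇒Reach ≐-refl) D₀⇝M)
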